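{- Let $A$ be an integer matrix with columns $\mathbf{a}_1,\dots,\mathbf{a}_k$. If the equation $A\mathbf{x}=\mathbf{0}$ is graph-regular, then $\sum_{i=1}^k\mathbf{a}_i=\mathbf{0}$.
   Context: Write $[N]=\{1,\dots,N\}$. For an integer matrix $A$ with $k\ge 3$ columns, the equation $A\mathbf{x}=\mathbf{0}$ is called graph-regular if there is a function $N_A(r)$ such that for every $r\in\mathbb{N}$ and every $N>N_A(r)$, every $r$-coloring of the edges of the complete graph on vertex set $[N]$ admits a vector $\mathbf{x}=(x(1),\dots,x(k))\in[N]^k$ with $A\mathbf{x}=\mathbf{0}$ such that the values $x(1),\dots,x(k)$ are pairwise distinct and all edges $\{x(i),x(j)\}$ ($i\ne j$) have the same color. -}

module Defs where

open import Data.Nat using (ℕ; suc; _≤_; _<_)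
open import Data.Integer using (ℤ; +_; _+_; _*_)
open import Data.Fin using (Fin)
open import Data.Product using (Σ; _×_; ∃; ∃-syntax)
open import Relation.Binary.PropositionalEquality using (_≡_)
open import Relation.Nullary using (¬_)

Matrix : ℕ → ℕ → Set
Matrix m k = Fin m → Fin k → ℤ

sumℤ : ∀ {k} → (Fin k → ℤ) → ℤ
sumℤ {ℕ.zero} f = + 0
sumℤ {suc k} f = f Fin.zero + sumℤ (λ j → f (Fin.suc j))

IsSolution : ∀ {m k} → Matrix m k → (Fin k → ℕ) → Set
IsSolution A x = ∀ i → sumℤ (λ j → A i j * + (x j)) ≡ + 0

-- An r-colouring of the edges of the complete graph on [N]:
-- a colour for each pair, symmetric, so it is a function of the unordered edge.
-- (Only its values on distinct pairs from [N] are ever used.)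
record EdgeColouring (r : ℕ) : Set where
  field
    colour : ℕ → ℕ → Fin r
    symmetric : ∀ a b → colour a b ≡ colour b a
open EdgeColouring public

InRange : ℕ → ℕ → Set
InRange N a = (1 ≤ a) × (a ≤ N)

MonochromaticSolution : ∀ {m k r} → Matrix m k → ℕ → EdgeColouring r → (Fin k → ℕ) → Set
MonochromaticSolution {k = k} {r = r} A N c x =
  IsSolution A x
  × (∀ j → InRange N (x j))
  × (∀ i j → ¬ i ≡ j → ¬ x i ≡ x j)
  × (∃[ col ] (∀ i j → ¬ i ≡ j → colour c (x i) (x j) ≡ col))

-- Graph-regularity (for k ≥ 3 columns; the hypothesis k ≥ 3 is imposed in the statement).
-- r ranges over ℕ = positive integers.
GraphRegular : ∀ {m k} → Matrix m k → Set
GraphRegular {m} {k} A =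
  Σ (ℕ → ℕ) λ NA →
    ∀ (r : ℕ) → 1 ≤ r → ∀ (N : ℕ) → NA r < N →
    (c : EdgeColouring r) → ∃[ x ] MonochromaticSolution A N c x

module Submission where

-- Split a row c of A as c = α - β into its positive and negative parts, so the
-- row equation reads α · x = β · x and Σ c = 0 means Σα = Σβ.  With
-- K = Σα + Σβ, colour {a, b} (a ≤ b) by the relative gap ⌊K (b - a) / a⌋
-- capped at K²; regularity gives a monochromatic solution with at least three
-- distinct positive entries.  Gaps are superadditive, so a colour t below the
-- cap must be 0: all entries are within a factor (K+1)/K of the smallest, and
-- comparing with it gives K Σβ ≤ (K+1) Σα and K Σα ≤ (K+1) Σβ, hence Σα = Σβ.
-- At the cap, entries are pairwise a factor K + 1 apart, so the largest entry
-- with nonzero coefficient outweighs all other terms, leaving only zero rows.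

open import Defs
open import Data.Nat using (ℕ; zero; suc; _+_; _*_; _∸_; _⊓_; _⊔_; _≤_; _<_; z≤n; s≤s; _<?_; _≤?_; >-nonZero)
open import Data.Nat.Properties
open import Data.Nat.DivMod using (_/_; _%_; m/n*n≤m; m≡m%n+[m/n]*n; m%n<n)
open import Data.Integer as ℤ using (ℤ; +_; -[1+_])
import Data.Integer.Properties as ℤP
open import Algebra.Properties.Semiring.Sum +-*-semiring
  using (sum; sum-cong-≗; sum-remove; sum-replicate-zero; *-distribˡ-sum; *-distribʳ-sum)
open import Algebra.Properties.CommutativeSemigroup *-commutativeSemigroup
  using (x∙yz≈y∙xz; x∙yz≈yx∙z)
import Algebra.Properties.CommutativeMonoid.Sum ℤP.+-0-commutativeMonoid as ℤΣ
open import Algebra.Properties.AbelianGroup ℤP.+-0-abelianGroup using (identityˡ-unique)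
open import Data.Fin using (Fin; zero; suc; toℕ; fromℕ<)
import Data.Fin.Properties as Fin
open import Data.Product using (∃-syntax; _×_; _,_; proj₁)
open import Data.Sum using (_⊎_; inj₁; inj₂; reduce)
open import Data.Unit using (⊤; tt)
open import Data.Empty using (⊥; ⊥-elim)
open import Function using (_∘_)
open import Relation.Binary.Definitions using (Transitive; Total; tri<; tri≈; tri>)
open import Relation.Nullary using (¬_; Dec; yes; no)
open import Relation.Unary using (Pred; Decidable)
open import Relation.Binary.PropositionalEquality

sum-mono : ∀ {k} {f g : Fin k → ℕ} → (∀ j → f j ≤ g j) → sum f ≤ sum g
sum-mono {zero}  f≤g = z≤n
sum-mono {suc k} f≤g = +-mono-≤ (f≤g zero) (sum-mono (f≤g ∘ suc))

term≤sum : ∀ {k} (f : Fin k → ℕ) j → f j ≤ sum f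
term≤sum {suc k} f j = ≤-trans (m≤m+n (f j) _) (≤-reflexive (sym (sum-remove {i = j} f)))

sum-zero : ∀ {k} {f : Fin k → ℕ} → (∀ j → f j ≡ 0) → sum f ≡ 0
sum-zero {k} f≡0 = trans (sum-cong-≗ f≡0) (sum-replicate-zero k)

infix 7 _·_
_·_ : ∀ {k} → (Fin k → ℕ) → (Fin k → ℕ) → ℕ
α · x = sum (λ j → α j * x j)

·-mono : ∀ {k} (α : Fin k → ℕ) {x y : Fin k → ℕ} →
         (∀ j → 1 ≤ α j → x j ≤ y j) → α · x ≤ α · y
·-mono α x≤y = sum-mono (λ j → weighted (α j) (x≤y j))
  where
  weighted : ∀ a {b c} → (1 ≤ a → b ≤ c) → a * b ≤ a * c
  weighted zero    _   = z≤n
  weighted (suc a) b≤c = *-monoʳ-≤ (suc a) (b≤c (s≤s z≤n))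

·-const : ∀ {k} (α : Fin k → ℕ) y → α · (λ _ → y) ≡ sum α * y
·-const α y = sym (*-distribʳ-sum y α)

·-scale : ∀ {k} (α x : Fin k → ℕ) c → α · (λ j → c * x j) ≡ c * (α · x)
·-scale α x c = trans (sum-cong-≗ (λ j → x∙yz≈y∙xz (α j) c (x j)))
                      (sym (*-distribˡ-sum c (λ j → α j * x j)))

close⇒nearly-balanced : ∀ {k} (α β x : Fin k → ℕ) K x₀ → 1 ≤ x₀ →
  (∀ j → x₀ ≤ x j) → (∀ j → K * x j ≤ suc K * x₀) →
  α · x ≡ β · x → K * sum β ≤ suc K * sum α
close⇒nearly-balanced α β x K x₀ x₀≥1 above below eq =
  *-cancelʳ-≤ (K * sum β) (suc K * sum α) x₀ {{>-nonZero x₀≥1}} (begin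
    K * sum β * x₀             ≡⟨ *-assoc K (sum β) x₀ ⟩
    K * (sum β * x₀)           ≡⟨ cong (K *_) (sym (·-const β x₀)) ⟩
    K * (β · (λ _ → x₀))       ≤⟨ *-monoʳ-≤ K (·-mono β (λ j _ → above j)) ⟩
    K * (β · x)                ≡⟨ cong (K *_) (sym eq) ⟩
    K * (α · x)                ≡⟨ sym (·-scale α x K) ⟩
    α · (λ j → K * x j)        ≤⟨ ·-mono α (λ j _ → below j) ⟩
    α · (λ _ → suc K * x₀)     ≡⟨ ·-const α (suc K * x₀) ⟩
    sum α * (suc K * x₀)       ≡⟨ x∙yz≈yx∙z (sum α) (suc K) x₀ ⟩
    suc K * sum α * x₀         ∎)
  where open ≤-Reasoning

unbalanced : ∀ {p q} → p < q → ¬ (p + q) * q ≤ suc (p + q) * p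
unbalanced {p} {q} p<q = <⇒≱ (begin-strict
    suc (p + q) * p        ≡⟨⟩
    p + (p + q) * p        <⟨ +-monoˡ-< ((p + q) * p) (m<m+n p (≤-trans (s≤s z≤n) p<q)) ⟩
    (p + q) + (p + q) * p  ≡⟨ sym (*-suc (p + q) p) ⟩
    (p + q) * suc p        ≤⟨ *-monoʳ-≤ (p + q) p<q ⟩
    (p + q) * q            ∎)
  where open ≤-Reasoning

nearly-balanced⇒balanced : ∀ p q → (p + q) * q ≤ suc (p + q) * p →
                           (p + q) * p ≤ suc (p + q) * q → p ≡ q
nearly-balanced⇒balanced p q qp pq with <-cmp p q
... | tri< p<q _ _ = ⊥-elim (unbalanced p<q qp)
... | tri≈ _ p≡q _ = p≡q
... | tri> _ _ q<p = ⊥-elim (unbalanced q<p (subst (λ K → K * p ≤ suc K * q) (+-comm p q) pq))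

dominant : ∀ {k} (α β x : Fin k → ℕ) L m → sum α ≤ L → 1 ≤ β m → 1 ≤ x m →
           (∀ j → 1 ≤ α j → suc L * x j ≤ x m) → α · x < β · x
dominant α β x L m Σα≤L βₘ≥1 xₘ≥1 small = *-cancelˡ-< (suc L) (α · x) (β · x) (begin-strict
    suc L * (α · x)            ≡⟨ sym (·-scale α x (suc L)) ⟩
    α · (λ j → suc L * x j)    ≤⟨ ·-mono α small ⟩
    α · (λ _ → x m)            ≡⟨ ·-const α (x m) ⟩
    sum α * x m                ≤⟨ *-monoˡ-≤ (x m) Σα≤L ⟩
    L * x m                    <⟨ m<n+m (L * x m) xₘ≥1 ⟩
    suc L * x m                ≤⟨ *-monoʳ-≤ (suc L) (m≤n*m (x m) (β m) {{>-nonZero βₘ≥1}}) ⟩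
    suc L * (β m * x m)        ≤⟨ *-monoʳ-≤ (suc L) (term≤sum (λ j → β j * x j) m) ⟩
    suc L * (β · x)            ∎)
  where open ≤-Reasoning

extremal : ∀ {a ℓ p} {A : Set a} {_≼_ : A → A → Set ℓ} → Transitive _≼_ → Total _≼_ →
           ∀ {k} {P : Pred (Fin k) p} → Decidable P → (f : Fin k → A) →
           (∀ j → ¬ P j) ⊎ ∃[ m ] (P m × ∀ j → P j → f j ≼ f m)
extremal ≼-trans ≼-total {zero} P? f = inj₁ (λ ())
extremal ≼-trans ≼-total {suc k} {P = P} P? f
  with P? zero | extremal ≼-trans ≼-total {P = P ∘ suc} (P? ∘ suc) (f ∘ suc)
... | no ¬P₀ | inj₁ none = inj₁ λ { zero → ¬P₀ ; (suc j) → none j }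
... | no ¬P₀ | inj₂ (m , Pₘ , max) =
  inj₂ (suc m , Pₘ , λ { zero P₀ → ⊥-elim (¬P₀ P₀) ; (suc j) → max j })
... | yes P₀ | inj₁ none =
  inj₂ (zero , P₀ , λ { zero _ → reduce (≼-total _ _) ; (suc j) Pⱼ → ⊥-elim (none j Pⱼ) })
... | yes P₀ | inj₂ (m , Pₘ , max) with ≼-total (f zero) (f (suc m))
...   | inj₁ f₀≼fₘ = inj₂ (suc m , Pₘ , λ { zero _ → f₀≼fₘ ; (suc j) → max j })
...   | inj₂ fₘ≼f₀ = inj₂ (zero , P₀ , λ { zero _ → reduce (≼-total _ _)
                                          ; (suc j) Pⱼ → ≼-trans (max j Pⱼ) fₘ≼f₀ })

minimum : ∀ {k} (f : Fin (suc k) → ℕ) → ∃[ m ] (∀ j → f m ≤ f j)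
minimum f with extremal {_≼_ = λ a b → b ≤ a} (λ b≤a c≤b → ≤-trans c≤b b≤a)
                        (λ a b → ≤-total b a) {P = λ _ → ⊤} (λ _ → yes tt) f
... | inj₁ none            = ⊥-elim (none zero tt)
... | inj₂ (m , _ , least) = m , λ j → least j tt

_⁺ _⁻ : ℤ → ℕ
(+ n) ⁺    = n
-[1+ n ] ⁺ = 0
(+ n) ⁻    = 0
-[1+ n ] ⁻ = suc n

⁺⁻-split : ∀ c → c ℤ.+ + (c ⁻) ≡ + (c ⁺)
⁺⁻-split (+ n)    = ℤP.+-identityʳ (+ n)
⁺⁻-split -[1+ n ] = ℤP.+-inverseˡ (+ suc n)

⁺⁻-disjoint : ∀ c → c ⁺ ≡ 0 ⊎ c ⁻ ≡ 0
⁺⁻-disjoint (+ n)    = inj₂ refl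
⁺⁻-disjoint -[1+ n ] = inj₁ refl

split-scale : ∀ {g a b} x → g ℤ.+ + b ≡ + a → g ℤ.* + x ℤ.+ + (b * x) ≡ + (a * x)
split-scale {g} {a} {b} x g+b≡a = begin
    g ℤ.* + x ℤ.+ + (b * x)     ≡⟨ cong (λ n → g ℤ.* + x ℤ.+ n) (ℤP.pos-* b x) ⟩
    g ℤ.* + x ℤ.+ + b ℤ.* + x   ≡⟨ sym (ℤP.*-distribʳ-+ (+ x) g (+ b)) ⟩
    (g ℤ.+ + b) ℤ.* + x         ≡⟨ cong (ℤ._* + x) g+b≡a ⟩
    + a ℤ.* + x                 ≡⟨ sym (ℤP.pos-* a x) ⟩
    + (a * x)                   ∎
  where open ≡-Reasoning

sumℤ≡sum : ∀ {k} (g : Fin k → ℤ) → sumℤ g ≡ ℤΣ.sum g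
sumℤ≡sum {zero}  g = refl
sumℤ≡sum {suc k} g = cong (λ s → g zero ℤ.+ s) (sumℤ≡sum (g ∘ suc))

pos-sum : ∀ {k} (a : Fin k → ℕ) → + sum a ≡ ℤΣ.sum (λ j → + a j)
pos-sum {zero}  a = refl
pos-sum {suc k} a = trans (ℤP.pos-+ (a zero) (sum (a ∘ suc)))
                          (cong (λ s → + a zero ℤ.+ s) (pos-sum (a ∘ suc)))

sum-split : ∀ {k} (g : Fin k → ℤ) (a b : Fin k → ℕ) →
            (∀ j → g j ℤ.+ + b j ≡ + a j) → sumℤ g ℤ.+ + sum b ≡ + sum a
sum-split g a b split = begin
    sumℤ g ℤ.+ + sum b                   ≡⟨ cong₂ ℤ._+_ (sumℤ≡sum g) (pos-sum b) ⟩
    ℤΣ.sum g ℤ.+ ℤΣ.sum (λ j → + b j)    ≡⟨ sym (ℤΣ.∑-distrib-+ g (λ j → + b j)) ⟩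
    ℤΣ.sum (λ j → g j ℤ.+ + b j)         ≡⟨ ℤΣ.sum-cong-≗ split ⟩
    ℤΣ.sum (λ j → + a j)                 ≡⟨ sym (pos-sum a) ⟩
    + sum a                              ∎
  where open ≡-Reasoning

sum-split-zero⇒balanced : ∀ {k} (g : Fin k → ℤ) (a b : Fin k → ℕ) →
  (∀ j → g j ℤ.+ + b j ≡ + a j) → sumℤ g ≡ + 0 → sum a ≡ sum b
sum-split-zero⇒balanced g a b split g≡0 = ℤP.+-injective (begin
    + sum a                 ≡⟨ sym (sum-split g a b split) ⟩
    sumℤ g ℤ.+ + sum b      ≡⟨ cong (ℤ._+ + sum b) g≡0 ⟩
    + sum b                 ∎)
  where open ≡-Reasoning

balanced⇒sum-split-zero : ∀ {k} (g : Fin k → ℤ) (a b : Fin k → ℕ) →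
  (∀ j → g j ℤ.+ + b j ≡ + a j) → sum a ≡ sum b → sumℤ g ≡ + 0
balanced⇒sum-split-zero g a b split a≡b =
  identityˡ-unique (sumℤ g) (+ sum b) (trans (sum-split g a b split) (cong +_ a≡b))

-- gap K a b = ⌊K (b ∸ a) / a⌋ : how far b lies above a, in units of a / K.
gap : ℕ → ℕ → ℕ → ℕ
gap K zero      b = 0
gap K a@(suc _) b = K * (b ∸ a) / a

gap-lower : ∀ K a b → gap K a b * a ≤ K * (b ∸ a)
gap-lower K zero      b = z≤n
gap-lower K a@(suc _) b = m/n*n≤m (K * (b ∸ a)) a

gap-upper : ∀ K a b → 1 ≤ a → K * (b ∸ a) < suc (gap K a b) * a
gap-upper K a@(suc _) b _ = begin-strict
    K * (b ∸ a)                          ≡⟨ m≡m%n+[m/n]*n (K * (b ∸ a)) a ⟩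
    K * (b ∸ a) % a + gap K a b * a      <⟨ +-monoˡ-< (gap K a b * a) (m%n<n (K * (b ∸ a)) a) ⟩
    suc (gap K a b) * a                  ∎
  where open ≤-Reasoning

gap≡0⇒close : ∀ K {a b} → 1 ≤ a → gap K a b ≡ 0 → K * b ≤ suc K * a
gap≡0⇒close K {a} {b} a≥1 gap≡0 = begin
    K * b                    ≤⟨ *-monoʳ-≤ K (m≤n+m∸n b a) ⟩
    K * (a + (b ∸ a))        ≡⟨ *-distribˡ-+ K a (b ∸ a) ⟩
    K * a + K * (b ∸ a)      ≤⟨ +-monoʳ-≤ (K * a) (<⇒≤ (subst (λ g → K * (b ∸ a) < suc g * a) gap≡0
                                                              (gap-upper K a b a≥1))) ⟩
    K * a + (a + 0)          ≡⟨ cong (λ n → K * a + n) (+-identityʳ a) ⟩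
    K * a + a                ≡⟨ +-comm (K * a) a ⟩
    suc K * a                ∎
  where open ≤-Reasoning

gap≥K²⇒far : ∀ K {a b} → a ≤ b → K * K ≤ gap K a b → suc K * a ≤ b
gap≥K²⇒far zero {a} a≤b _ = subst (_≤ _) (sym (+-identityʳ a)) a≤b
gap≥K²⇒far K@(suc _) {a} {b} a≤b big = begin
    a + K * a          ≤⟨ +-monoʳ-≤ a Ka≤b∸a ⟩
    a + (b ∸ a)        ≡⟨ m+[n∸m]≡n a≤b ⟩
    b                  ∎
  where
  open ≤-Reasoning
  Ka≤b∸a : K * a ≤ b ∸ a
  Ka≤b∸a = *-cancelˡ-≤ K (begin
    K * (K * a)        ≡⟨ sym (*-assoc K K a) ⟩
    K * K * a          ≤⟨ *-monoˡ-≤ a big ⟩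
    gap K a b * a      ≤⟨ gap-lower K a b ⟩
    K * (b ∸ a)        ∎)

∸-split : ∀ {u v w} → u ≤ v → v ≤ w → (v ∸ u) + (w ∸ v) ≡ w ∸ u
∸-split {u} {v} {w} u≤v v≤w = begin
    (v ∸ u) + (w ∸ v)   ≡⟨ +-comm (v ∸ u) (w ∸ v) ⟩
    (w ∸ v) + (v ∸ u)   ≡⟨ sym (+-∸-assoc (w ∸ v) u≤v) ⟩
    (w ∸ v) + v ∸ u     ≡⟨ cong (_∸ u) (m∸n+n≡m v≤w) ⟩
    w ∸ u               ∎
  where open ≡-Reasoning

-- Gaps are superadditive, so u < v < w never carry the same positive gap on
-- all three pairs.
gap-triangle : ∀ K {u v w t} → u < v → v < w →
               gap K u v ≡ t → gap K v w ≡ t → gap K u w ≡ t → t ≡ 0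
gap-triangle K {zero}                    _   _   refl _ _ = refl
gap-triangle K {suc _} {t = zero}        _   _   _    _ _ = refl
gap-triangle K {u@(suc _)} {v} {w} {t@(suc _)} u<v v<w uv vw uw =
  ⊥-elim (<⇒≱ tv<u (≤-trans (<⇒≤ u<v) (m≤n*m v t)))
  where
  open ≤-Reasoning
  tv<u : t * v < u
  tv<u = +-cancelˡ-< (t * u) (t * v) u (begin-strict
    t * u + t * v               ≤⟨ +-mono-≤ (subst (λ g → g * u ≤ K * (v ∸ u)) uv (gap-lower K u v))
                                            (subst (λ g → g * v ≤ K * (w ∸ v)) vw (gap-lower K v w)) ⟩
    K * (v ∸ u) + K * (w ∸ v)   ≡⟨ sym (*-distribˡ-+ K (v ∸ u) (w ∸ v)) ⟩
    K * ((v ∸ u) + (w ∸ v))     ≡⟨ cong (K *_) (∸-split (<⇒≤ u<v) (<⇒≤ v<w)) ⟩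
    K * (w ∸ u)                 <⟨ subst (λ g → K * (w ∸ u) < suc g * u) uw (gap-upper K u w (s≤s z≤n)) ⟩
    u + t * u                   ≡⟨ +-comm u (t * u) ⟩
    t * u + u                   ∎)

dist : ℕ → ℕ → ℕ → ℕ
dist K a b = gap K (a ⊓ b) (a ⊔ b)

dist-sym : ∀ K a b → dist K a b ≡ dist K b a
dist-sym K a b = cong₂ (gap K) (⊓-comm a b) (⊔-comm a b)

dist-≤ : ∀ K {a b} → a ≤ b → dist K a b ≡ gap K a b
dist-≤ K a≤b = cong₂ (gap K) (m≤n⇒m⊓n≡m a≤b) (m≤n⇒m⊔n≡n a≤b)

≢⇒<⊎> : ∀ {u v} → u ≢ v → u < v ⊎ v < u
≢⇒<⊎> {u} {v} u≢v with <-cmp u v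
... | tri< u<v _ _ = inj₁ u<v
... | tri≈ _ u≡v _ = ⊥-elim (u≢v u≡v)
... | tri> _ _ v<u = inj₂ v<u

by-sorting : ∀ {ℓ} (P : ℕ → ℕ → ℕ → Set ℓ) →
  (∀ {u v w} → P u v w → P v u w) → (∀ {u v w} → P u w v → P u v w) →
  (∀ {u v w} → u < v → v < w → P u v w) →
  ∀ {u v w} → u ≢ v → v ≢ w → u ≢ w → P u v w
by-sorting P swap₁₂ swap₂₃ sorted u≢v v≢w u≢w with ≢⇒<⊎> u≢v | ≢⇒<⊎> v≢w
... | inj₁ u<v | inj₁ v<w = sorted u<v v<w
... | inj₂ v<u | inj₂ w<v = swap₁₂ (swap₂₃ (swap₁₂ (sorted w<v v<u)))
... | inj₁ u<v | inj₂ w<v with ≢⇒<⊎> u≢w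
...   | inj₁ u<w = swap₂₃ (sorted u<w w<v)
...   | inj₂ w<u = swap₂₃ (swap₁₂ (sorted w<u u<v))
by-sorting P swap₁₂ swap₂₃ sorted u≢v v≢w u≢w | inj₂ v<u | inj₁ v<w with ≢⇒<⊎> u≢w
...   | inj₁ u<w = swap₁₂ (sorted v<u u<w)
...   | inj₂ w<u = swap₁₂ (swap₂₃ (sorted v<w w<u))

EqualDistances : ℕ → ℕ → ℕ → ℕ → ℕ → Set
EqualDistances K t u v w = dist K u v ≡ t × dist K v w ≡ t × dist K u w ≡ t

dist-triangle : ∀ K {t u v w} → u ≢ v → v ≢ w → u ≢ w → EqualDistances K t u v w → t ≡ 0
dist-triangle K {t} = by-sorting (λ u v w → EqualDistances K t u v w → t ≡ 0)
  (λ {u} {v} {w} → swap₁₂ {u} {v} {w}) (λ {u} {v} {w} → swap₂₃ {u} {v} {w}) sorted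
  where
  swap₁₂ : ∀ {u v w} → (EqualDistances K t u v w → t ≡ 0) → EqualDistances K t v u w → t ≡ 0
  swap₁₂ {u} {v} triangle (vu , uw , vw) = triangle (trans (dist-sym K u v) vu , vw , uw)
  swap₂₃ : ∀ {u v w} → (EqualDistances K t u w v → t ≡ 0) → EqualDistances K t u v w → t ≡ 0
  swap₂₃ {u} {v} {w} triangle (uv , vw , uw) = triangle (uw , trans (dist-sym K w v) vw , uv)
  sorted : ∀ {u v w} → u < v → v < w → EqualDistances K t u v w → t ≡ 0
  sorted u<v v<w (uv , vw , uw) =
    gap-triangle K u<v v<w (trans (sym (dist-≤ K (<⇒≤ u<v))) uv)
                           (trans (sym (dist-≤ K (<⇒≤ v<w))) vw)
                           (trans (sym (dist-≤ K (<⇒≤ (<-trans u<v v<w)))) uw)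

capAt : (T d : ℕ) → Fin (suc T)
capAt T d = fromℕ< (s≤s (m⊓n≤n d T))

gapColouring : (K : ℕ) → EdgeColouring (suc (K * K))
gapColouring K = record
  { colour    = λ a b → capAt (K * K) (dist K a b)
  ; symmetric = λ a b → cong (capAt (K * K)) (dist-sym K a b) }

gapColouring-colour : ∀ K a b → toℕ (colour (gapColouring K) a b) ≡ dist K a b ⊓ (K * K)
gapColouring-colour K a b = Fin.toℕ-fromℕ< (s≤s (m⊓n≤n (dist K a b) (K * K)))

cap-below : ∀ {d T t} → d ⊓ T ≡ t → t < T → d ≡ t
cap-below {d} {T} d⊓T≡t t<T with ≤-total d T
... | inj₁ d≤T = trans (sym (m≤n⇒m⊓n≡m d≤T)) d⊓T≡t
... | inj₂ T≤d = ⊥-elim (<-irrefl (trans (sym d⊓T≡t) (m≥n⇒m⊓n≡n T≤d)) t<T)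

cap-reached : ∀ {d T t} → d ⊓ T ≡ t → ¬ t < T → T ≤ d
cap-reached {d} {T} d⊓T≡t t≮T = ≤-trans (≮⇒≥ t≮T) (subst (_≤ d) d⊓T≡t (m⊓n≤m d T))

-- Below the cap: if all pairwise distances vanish, α · x = β · x forces
-- Σα = Σβ (compare everything with the smallest entry).
close-solution⇒balanced : ∀ {k} (α β x : Fin (suc k) → ℕ) → (∀ j → 1 ≤ x j) →
  (∀ i j → i ≢ j → dist (sum α + sum β) (x i) (x j) ≡ 0) →
  α · x ≡ β · x → sum α ≡ sum β
close-solution⇒balanced α β x positive dist≡0 eq with minimum x
... | m , least = nearly-balanced⇒balanced (sum α) (sum β)
                    (close⇒nearly-balanced α β x K (x m) (positive m) least close eq)
                    (close⇒nearly-balanced β α x K (x m) (positive m) least close (sym eq))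
  where
  K : ℕ
  K = sum α + sum β
  close : ∀ j → K * x j ≤ suc K * x m
  close j with j Fin.≟ m
  ... | yes refl = m≤n+m (K * x m) (x m)
  ... | no j≢m   = gap≡0⇒close K (positive m)
                     (trans (sym (dist-≤ K (least j))) (dist≡0 m j (j≢m ∘ sym)))

-- At the cap: if entries are pairwise a factor K + 1 apart, where
-- K = Σα + Σβ, the largest entry with nonzero coefficient dominates, so
-- α · x = β · x only when both weights vanish.
spread-solution⇒balanced : ∀ {k} (α β x : Fin k → ℕ) → (∀ j → α j ≡ 0 ⊎ β j ≡ 0) →
  (∀ j → 1 ≤ x j) → (∀ i j → i ≢ j → x i ≢ x j) →
  (∀ i j → x i < x j → suc (sum α + sum β) * x i ≤ x j) →
  α · x ≡ β · x → sum α ≡ sum β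
spread-solution⇒balanced {k} α β x disjoint positive distinct lacunary eq
  with extremal ≤-trans ≤-total (λ j → 1 ≤? α j + β j) x
... | inj₁ unsupported = trans (sum-zero (λ j → m+n≡0⇒m≡0 (α j) (vanishes j)))
                               (sym (sum-zero (λ j → m+n≡0⇒n≡0 (α j) (vanishes j))))
  where
  vanishes : ∀ j → α j + β j ≡ 0
  vanishes j = n≤0⇒n≡0 (≮⇒≥ (unsupported j))
... | inj₂ (m , supported , largest) = ⊥-elim (one-sided (disjoint m))
  where
  K : ℕ
  K = sum α + sum β
  dominated : ∀ (γ : Fin k → ℕ) → γ m ≡ 0 → (∀ j → γ j ≤ α j + β j) →
              ∀ j → 1 ≤ γ j → suc K * x j ≤ x m
  dominated γ γₘ≡0 γ≤α+β j γⱼ≥1 =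
    lacunary j m (≤∧≢⇒< (largest j (≤-trans γⱼ≥1 (γ≤α+β j))) (distinct j m j≢m))
    where
    j≢m : j ≢ m
    j≢m refl with () ← subst (1 ≤_) γₘ≡0 γⱼ≥1
  one-sided : α m ≡ 0 ⊎ β m ≡ 0 → ⊥
  one-sided (inj₁ αₘ≡0) = <-irrefl eq (dominant α β x K m (m≤m+n (sum α) (sum β))
    (subst (λ a → 1 ≤ a + β m) αₘ≡0 supported) (positive m)
    (dominated α αₘ≡0 (λ j → m≤m+n (α j) (β j))))
  one-sided (inj₂ βₘ≡0) = <-irrefl (sym eq) (dominant β α x K m (m≤n+m (sum β) (sum α))
    (≤-trans supported (≤-reflexive (trans (cong (λ b → α m + b) βₘ≡0) (+-identityʳ (α m)))))
    (positive m) (dominated β βₘ≡0 (λ j → m≤n+m (β j) (α j))))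

monochromatic-solution⇒balanced : ∀ {k} (α β x : Fin (3 + k) → ℕ) →
  (∀ j → α j ≡ 0 ⊎ β j ≡ 0) → (∀ j → 1 ≤ x j) → (∀ i j → i ≢ j → x i ≢ x j) →
  ∀ col → (∀ i j → i ≢ j → colour (gapColouring (sum α + sum β)) (x i) (x j) ≡ col) →
  α · x ≡ β · x → sum α ≡ sum β
monochromatic-solution⇒balanced {k} α β x disjoint positive distinct col monochromatic eq =
  byColour (t <? K * K)
  where
  K : ℕ
  K = sum α + sum β
  t : ℕ
  t = toℕ col
  capped : ∀ i j → i ≢ j → dist K (x i) (x j) ⊓ (K * K) ≡ t
  capped i j i≢j = trans (sym (gapColouring-colour K (x i) (x j))) (cong toℕ (monochromatic i j i≢j))
  byColour : Dec (t < K * K) → sum α ≡ sum β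
  byColour (yes below) = close-solution⇒balanced α β x positive (λ i j i≢j → trans (same i j i≢j) t≡0) eq
    where
    same : ∀ i j → i ≢ j → dist K (x i) (x j) ≡ t
    same i j i≢j = cap-below (capped i j i≢j) below
    i₀ i₁ i₂ : Fin (3 + k)
    i₀ = zero
    i₁ = suc zero
    i₂ = suc (suc zero)
    t≡0 : t ≡ 0
    t≡0 = dist-triangle K (distinct i₀ i₁ (λ ())) (distinct i₁ i₂ (λ ())) (distinct i₀ i₂ (λ ()))
                          (same i₀ i₁ (λ ()) , same i₁ i₂ (λ ()) , same i₀ i₂ (λ ()))
  byColour (no atCap) = spread-solution⇒balanced α β x disjoint positive distinct lacunary eq
    where
    lacunary : ∀ i j → x i < x j → suc K * x i ≤ x j
    lacunary i j xᵢ<xⱼ = gap≥K²⇒far K (<⇒≤ xᵢ<xⱼ)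
      (subst (K * K ≤_) (dist-≤ K (<⇒≤ xᵢ<xⱼ)) (cap-reached (capped i j i≢j) atCap))
      where
      i≢j : i ≢ j
      i≢j refl = <-irrefl refl xᵢ<xⱼ

lemma3p1 : (m k : ℕ) → 3 ≤ k → (A : Matrix m k) → GraphRegular A →
           ∀ i → sumℤ (λ j → A i j) ≡ + 0
lemma3p1 m (suc (suc (suc k))) (s≤s (s≤s (s≤s _))) A (bound , regular) i =
  balanced⇒sum-split-zero (λ j → A i j) α β (λ j → ⁺⁻-split (A i j))
    (balanced (regular r (s≤s z≤n) (suc (bound r)) ≤-refl (gapColouring K)))
  where
  α β : Fin (3 + k) → ℕ
  α j = A i j ⁺
  β j = A i j ⁻
  K : ℕ
  K = sum α + sum β
  r : ℕ
  r = suc (K * K)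
  balanced : ∃[ x ] MonochromaticSolution A (suc (bound r)) (gapColouring K) x → sum α ≡ sum β
  balanced (x , solves , inRange , distinct , col , monochromatic) =
    monochromatic-solution⇒balanced α β x (λ j → ⁺⁻-disjoint (A i j)) (proj₁ ∘ inRange)
      distinct col monochromatic
      (sum-split-zero⇒balanced (λ j → A i j ℤ.* + x j) (λ j → α j * x j) (λ j → β j * x j)
         (λ j → split-scale {A i j} (x j) (⁺⁻-split (A i j))) (solves i))
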